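{- The logic $\mathsf{2CH}$ is sound with respect to chromatic hypergraphs: for every agent $a$ and agent formula $\varphi$ of sort $a$, if $\vdash_a\varphi$ then $H,v\models_a\varphi$ for every chromatic hypergraph model $H$ and every $v\in V_a$; and for every world formula $\Phi$, if $\vdash_e\Phi$ then $H,e\models_e\Phi$ for every chromatic hypergraph model $H$ and every hyperedge $e\in E$.
   Context: Syntax. Fix a finite set $\mathcal{A}$ of agents, sets $AP_a$ ($a\in\mathcal A$) and $AP_e$ of atomic propositions. Agent formulas of sort $a$: $\varphi ::= p_a \mid \neg\varphi \mid \varphi\wedge\psi \mid \Diamond_a\Phi$ ($p_a\in AP_a$, $\Phi$ a world formula). World formulas: $\Phi ::= p_e \mid \neg\Phi \mid \Phi\wedge\Psi \mid \langle a\rangle\varphi$ ($p_e\in AP_e$, $\varphi$ of sort $a$). Abbreviations: usual $\top,\bot,\vee,\to$; $\Box_a\Phi:=\neg\Diamond_a\neg\Phi$; $[a]\varphi:=\neg\langle a\rangle\neg\varphi$. Proof system. $\vdash_a$, $\vdash_e$ are the least relations containing all propositional tautology instances at each sort, closed under modus ponens at each sort, and under: from $\vdash_e\Phi$ infer $\vdash_a\Box_a\Phi$; from $\vdash_a\varphi$ infer $\vdash_e[a]\varphi$; from $\vdash_e\Phi\to\Psi$ infer $\vdash_a\Diamond_a\Phi\to\Diamond_a\Psi$ and $\vdash_a\Box_a\Phi\to\Box_a\Psi$; from $\vdash_a\varphi\to\psi$ infer $\vdash_e\langle a\rangle\varphi\to\langle a\rangle\psi$ and $\vdash_e[a]\varphi\to[a]\psi$;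 $\vdash_e\Phi\to[a]\psi$ iff $\vdash_a\Diamond_a\Phi\to\psi$; $\vdash_a\varphi\to\Box_a\Psi$ iff $\vdash_e\langle a\rangle\varphi\to\Psi$; axioms $\vdash_a\varphi\to\Diamond_a\langle a\rangle\varphi$, $\vdash_a\Diamond_a\langle a\rangle\varphi\to\varphi$, $\vdash_e\bigvee_{a\in\mathcal A}\langle a\rangle\top$. Semantics. A chromatic hypergraph $H=(E,\{V_a,\pi_a\}_{a\in\mathcal A})$: $E$ a set of hyperedges, $V_a$ sets of views, $\pi_a:E\rightharpoonup V_a$ surjective partial functions, each $e$ having $\pi_a(e)$ defined for at least one $a$. A model adds valuations $\ell_a:AP_a\to\mathcal P(V_a)$, $\ell_e:AP_e\to\mathcal P(E)$. $H,v\models_a p_a$ iff $v\in\ell_a(p_a)$; $H,e\models_e p_e$ iff $e\in\ell_e(p_e)$; $\neg,\wedge$ classical; $H,v\models_a\Diamond_a\Phi$ iff $H,e\models_e\Phi$ for some $e$ with $\pi_a(e)=v$; $H,e\models_e\langle a\rangle\varphi$ iff $\pi_a(e)$ is defined and $H,\pi_a(e)\models_a\varphi$. -}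

module Defs where

open import Data.Nat using (ℕ)
open import Data.Fin using (Fin)
open import Data.List using (List; foldr; map)
open import Data.List using () renaming (allFin to allFinL)
open import Data.Bool using (Bool; true; false; not; _∧_)
open import Data.Maybe using (Maybe; just; Is-just)
open import Data.Product using (Σ; _×_; ∃)
open import Relation.Binary.PropositionalEquality using (_≡_)
open import Relation.Nullary using (¬_)

-- Propositional formulas (schemas) over variables ℕ, used to define
-- "propositional tautology instances".
data PL : Set where
  var  : ℕ → PL
  ⊤p   : PL
  ¬p_  : PL → PL
  _∧p_ : PL → PL → PL

evalPL : (ℕ → Bool) → PL → Bool
evalPL ρ (var i)  = ρ i
evalPL ρ ⊤p       = true
evalPL ρ (¬p p)   = not (evalPL ρ p)
evalPL ρ (p ∧p q) = evalPL ρ p ∧ evalPL ρ q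

Tautology : PL → Set
Tautology p = ∀ (ρ : ℕ → Bool) → evalPL ρ p ≡ true

module Logic (n : ℕ) (AP : Fin n → Set) (APe : Set) where

  Agent : Set
  Agent = Fin n

  mutual
    data AF (a : Agent) : Set where
      atA  : AP a → AF a
      ⊤A   : AF a
      ¬A_  : AF a → AF a
      _∧A_ : AF a → AF a → AF a
      ◇    : WF → AF a

    data WF : Set where
      atE  : APe → WF
      ⊤E   : WF
      ¬E_  : WF → WF
      _∧E_ : WF → WF → WF
      ⟨_⟩_ : (a : Agent) → AF a → WF

  _⇒A_ : ∀ {a} → AF a → AF a → AF a
  φ ⇒A ψ = ¬A (φ ∧A (¬A ψ))

  _⇒E_ : WF → WF → WF
  Φ ⇒E Ψ = ¬E (Φ ∧E (¬E Ψ))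

  ⊥E : WF
  ⊥E = ¬E ⊤E

  _∨E_ : WF → WF → WF
  Φ ∨E Ψ = ¬E ((¬E Φ) ∧E (¬E Ψ))

  □ : ∀ {a} → WF → AF a
  □ Φ = ¬A (◇ (¬E Φ))

  [_]_ : (a : Agent) → AF a → WF
  [ a ] φ = ¬E (⟨ a ⟩ (¬A φ))

  someAgent : WF
  someAgent = foldr (λ a Φ → (⟨ a ⟩ ⊤A) ∨E Φ) ⊥E (allFinL n)

  instA : ∀ {a} → (ℕ → AF a) → PL → AF a
  instA σ (var i)  = σ i
  instA σ ⊤p       = ⊤A
  instA σ (¬p p)   = ¬A instA σ p
  instA σ (p ∧p q) = instA σ p ∧A instA σ q

  instE : (ℕ → WF) → PL → WF
  instE σ (var i)  = σ i
  instE σ ⊤p       = ⊤E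
  instE σ (¬p p)   = ¬E instE σ p
  instE σ (p ∧p q) = instE σ p ∧E instE σ q

  mutual
    data ⊢A : (a : Agent) → AF a → Set where
      tautA  : ∀ {a} (p : PL) (σ : ℕ → AF a) → Tautology p → ⊢A a (instA σ p)
      mpA    : ∀ {a} {φ ψ : AF a} → ⊢A a (φ ⇒A ψ) → ⊢A a φ → ⊢A a ψ
      necA   : ∀ {a} {Φ} → ⊢E Φ → ⊢A a (□ Φ)
      mono◇  : ∀ {a} {Φ Ψ} → ⊢E (Φ ⇒E Ψ) → ⊢A a (◇ Φ ⇒A ◇ Ψ)
      mono□  : ∀ {a} {Φ Ψ} → ⊢E (Φ ⇒E Ψ) → ⊢A a (□ Φ ⇒A □ Ψ)
      adj1→  : ∀ {a} {Φ} {ψ : AF a} → ⊢E (Φ ⇒E ([ a ] ψ)) → ⊢A a (◇ Φ ⇒A ψ)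
      adj2←  : ∀ {a} {φ : AF a} {Ψ} → ⊢E ((⟨ a ⟩ φ) ⇒E Ψ) → ⊢A a (φ ⇒A □ Ψ)
      unit   : ∀ {a} (φ : AF a) → ⊢A a (φ ⇒A ◇ (⟨ a ⟩ φ))
      counit : ∀ {a} (φ : AF a) → ⊢A a (◇ (⟨ a ⟩ φ) ⇒A φ)

    data ⊢E : WF → Set where
      tautE  : (p : PL) (σ : ℕ → WF) → Tautology p → ⊢E (instE σ p)
      mpE    : ∀ {Φ Ψ} → ⊢E (Φ ⇒E Ψ) → ⊢E Φ → ⊢E Ψ
      necE   : ∀ {a} {φ : AF a} → ⊢A a φ → ⊢E ([ a ] φ)
      mono⟨⟩ : ∀ {a} {φ ψ : AF a} → ⊢A a (φ ⇒A ψ) → ⊢E ((⟨ a ⟩ φ) ⇒E (⟨ a ⟩ ψ))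
      mono[] : ∀ {a} {φ ψ : AF a} → ⊢A a (φ ⇒A ψ) → ⊢E (([ a ] φ) ⇒E ([ a ] ψ))
      adj1←  : ∀ {a} {Φ} {ψ : AF a} → ⊢A a (◇ Φ ⇒A ψ) → ⊢E (Φ ⇒E ([ a ] ψ))
      adj2→  : ∀ {a} {φ : AF a} {Ψ} → ⊢A a (φ ⇒A □ Ψ) → ⊢E ((⟨ a ⟩ φ) ⇒E Ψ)
      cover  : ⊢E someAgent

  record Model : Set₁ where
    field
      E     : Set
      V     : Agent → Set
      π     : (a : Agent) → E → Maybe (V a)
      π-surj  : ∀ a (v : V a) → ∃ λ e → π a e ≡ just v
      π-cover : ∀ (e : E) → ∃ λ a → Is-just (π a e)
      ℓA    : (a : Agent) → AP a → V a → Set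
      ℓE    : APe → E → Set

  module _ (M : Model) where
    open Model M
    mutual
      _⊨A_ : ∀ {a} → V a → AF a → Set
      v ⊨A atA p   = ℓA _ p v
      v ⊨A ⊤A      = Data.Unit.⊤ where import Data.Unit
      v ⊨A (¬A φ)  = ¬ (v ⊨A φ)
      v ⊨A (φ ∧A ψ) = (v ⊨A φ) × (v ⊨A ψ)
      _⊨A_ {a} v (◇ Φ) = Σ E λ e → (π a e ≡ just v) × (e ⊨E Φ)

      _⊨E_ : E → WF → Set
      e ⊨E atE p    = ℓE p e
      e ⊨E ⊤E       = Data.Unit.⊤ where import Data.Unit
      e ⊨E (¬E Φ)   = ¬ (e ⊨E Φ)
      e ⊨E (Φ ∧E Ψ) = (e ⊨E Φ) × (e ⊨E Ψ)
      e ⊨E (⟨ a ⟩ φ) = Σ (V a) λ v → (π a e ≡ just v) × (v ⊨A φ)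

{-# OPTIONS --safe #-}
module Submission where

-- Reading ◇_a and ⟨a⟩ as existential images
-- along the relation π_a and its converse makes ◇_a ⊣ [a] and ⟨a⟩ ⊣ □_a
-- hold pointwise, so the adjunction and monotonicity rules preserve
-- validity. The axioms encode the frame conditions: the unit φ → ◇⟨a⟩φ
-- uses surjectivity of π_a, the counit ◇⟨a⟩φ → φ uses that π_a is a
-- (partial) function, and ⋁ ⟨a⟩⊤ says that every hyperedge has a colour.
-- Excluded middle is needed only because negation is interpreted as ¬ in
-- Set, so modus ponens for ⇒ and the tautologies are classical facts.

open import Defs
open import Data.Nat using (ℕ)
open import Data.Fin using (Fin)
open import Data.Product using (_×_; _,_)
open import Data.Unit using (⊤; tt)
open import Data.Maybe using (just; Is-just)
open import Data.Maybe.Properties using (just-injective)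
open import Data.List using (List; foldr)
open import Data.List.Relation.Unary.Any using (Any; here; there)
open import Data.List.Membership.Propositional using (lose)
open import Data.List.Membership.Propositional.Properties using (∈-allFin)
open import Level using (0ℓ)
open import Function using (id)
open import Axiom.ExcludedMiddle using (ExcludedMiddle)
open import Relation.Nullary using (¬_; Dec; does; proof)
open import Relation.Nullary.Decidable using (decidable-stable)
open import Relation.Nullary.Reflects using (Reflects; ofʸ; invert; ¬-reflects; _×-reflects_)
open import Relation.Binary.PropositionalEquality
  using (_≡_; refl; sym; trans; cong; cong₂; subst)

⟦_⟧ : PL → (ℕ → Set) → Set
⟦ var i ⟧  σ = σ i
⟦ ⊤p ⟧     σ = ⊤
⟦ ¬p p ⟧   σ = ¬ ⟦ p ⟧ σ
⟦ p ∧p q ⟧ σ = ⟦ p ⟧ σ × ⟦ q ⟧ σ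

evalPL-reflects : {σ : ℕ → Set} (d : ∀ i → Dec (σ i)) (p : PL) →
                  Reflects (⟦ p ⟧ σ) (evalPL (λ i → does (d i)) p)
evalPL-reflects d (var i)  = proof (d i)
evalPL-reflects d ⊤p       = ofʸ tt
evalPL-reflects d (¬p p)   = ¬-reflects (evalPL-reflects d p)
evalPL-reflects d (p ∧p q) = evalPL-reflects d p ×-reflects evalPL-reflects d q

tautology-holds : (σ : ℕ → Set) → (∀ i → Dec (σ i)) → (p : PL) → Tautology p → ⟦ p ⟧ σ
tautology-holds σ d p taut =
  invert (subst (Reflects _) (taut (λ i → does (d i))) (evalPL-reflects d p))

module Soundness (lem : ExcludedMiddle 0ℓ) {n : ℕ} {AP : Fin n → Set} {APe : Set}
                 (M : Logic.Model n AP APe) where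
  open Logic n AP APe
  open Model M

  _⊨a_ : ∀ {a} → V a → AF a → Set
  _⊨a_ = _⊨A_ M

  _⊨e_ : E → WF → Set
  _⊨e_ = _⊨E_ M

  classical-⇒-elim : {A B : Set} → ¬ (A × ¬ B) → A → B
  classical-⇒-elim a⇒b a = decidable-stable lem (λ ¬b → a⇒b (a , ¬b))

  ⊨a-instA : ∀ {a} (v : V a) (σ : ℕ → AF a) (p : PL) →
             v ⊨a instA σ p ≡ ⟦ p ⟧ (λ i → v ⊨a σ i)
  ⊨a-instA v σ (var i)  = refl
  ⊨a-instA v σ ⊤p       = refl
  ⊨a-instA v σ (¬p p)   = cong ¬_ (⊨a-instA v σ p)
  ⊨a-instA v σ (p ∧p q) = cong₂ _×_ (⊨a-instA v σ p) (⊨a-instA v σ q)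

  ⊨e-instE : (e : E) (σ : ℕ → WF) (p : PL) →
             e ⊨e instE σ p ≡ ⟦ p ⟧ (λ i → e ⊨e σ i)
  ⊨e-instE e σ (var i)  = refl
  ⊨e-instE e σ ⊤p       = refl
  ⊨e-instE e σ (¬p p)   = cong ¬_ (⊨e-instE e σ p)
  ⊨e-instE e σ (p ∧p q) = cong₂ _×_ (⊨e-instE e σ p) (⊨e-instE e σ q)

  ⊨-⟨⟩⊤ : ∀ {a e} → Is-just (π a e) → e ⊨e (⟨ a ⟩ ⊤A)
  ⊨-⟨⟩⊤ {a} {e} defined with π a e | defined
  ... | just v | _ = v , refl , tt

  ⊨-⋁ : ∀ {e} (f : Agent → WF) {xs : List Agent} →
        Any (λ a → e ⊨e f a) xs → e ⊨e foldr (λ a Φ → f a ∨E Φ) ⊥E xs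
  ⊨-⋁ f (here  sat) (¬head , _) = ¬head sat
  ⊨-⋁ f (there sat) (_ , ¬tail) = ¬tail (⊨-⋁ f sat)

  ⊨-someAgent : ∀ e → e ⊨e someAgent
  ⊨-someAgent e with π-cover e
  ... | a , defined = ⊨-⋁ (λ a → ⟨ a ⟩ ⊤A) (lose (∈-allFin a) (⊨-⟨⟩⊤ defined))

  mutual
    ⊢A⇒⊨A : ∀ {a} {φ : AF a} → ⊢A a φ → ∀ v → v ⊨a φ
    ⊢A⇒⊨A (tautA p σ taut) v =
      subst id (sym (⊨a-instA v σ p)) (tautology-holds _ (λ _ → lem) p taut)
    ⊢A⇒⊨A (mpA ⊢φ⇒ψ ⊢φ) v = classical-⇒-elim (⊢A⇒⊨A ⊢φ⇒ψ v) (⊢A⇒⊨A ⊢φ v)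
    ⊢A⇒⊨A (necA ⊢Φ) v (e , _ , ¬Φ) = ¬Φ (⊢E⇒⊨E ⊢Φ e)
    ⊢A⇒⊨A (mono◇ ⊢Φ⇒Ψ) v ((e , πe , Φe) , ¬◇Ψ) =
      ¬◇Ψ (e , πe , classical-⇒-elim (⊢E⇒⊨E ⊢Φ⇒Ψ e) Φe)
    ⊢A⇒⊨A (mono□ ⊢Φ⇒Ψ) v (□Φ , ¬□Ψ) =
      ¬□Ψ λ { (e , πe , ¬Ψ) → □Φ (e , πe , λ Φe → ¬Ψ (classical-⇒-elim (⊢E⇒⊨E ⊢Φ⇒Ψ e) Φe)) }
    ⊢A⇒⊨A (adj1→ ⊢Φ⇒[a]ψ) v ((e , πe , Φe) , ¬ψ) =
      classical-⇒-elim (⊢E⇒⊨E ⊢Φ⇒[a]ψ e) Φe (v , πe , ¬ψ)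
    ⊢A⇒⊨A (adj2← ⊢⟨a⟩φ⇒Ψ) v (φv , ¬□Ψ) =
      ¬□Ψ λ { (e , πe , ¬Ψ) → ¬Ψ (classical-⇒-elim (⊢E⇒⊨E ⊢⟨a⟩φ⇒Ψ e) (v , πe , φv)) }
    ⊢A⇒⊨A (unit φ) v (φv , ¬◇⟨a⟩φ) with π-surj _ v
    ... | e , πe = ¬◇⟨a⟩φ (e , πe , v , πe , φv)
    ⊢A⇒⊨A (counit φ) v ((e , πe , w , πe′ , φw) , ¬φ) =
      ¬φ (subst (_⊨a φ) (just-injective (trans (sym πe′) πe)) φw)

    ⊢E⇒⊨E : ∀ {Φ} → ⊢E Φ → ∀ e → e ⊨e Φ
    ⊢E⇒⊨E (tautE p σ taut) e =
      subst id (sym (⊨e-instE e σ p)) (tautology-holds _ (λ _ → lem) p taut)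
    ⊢E⇒⊨E (mpE ⊢Φ⇒Ψ ⊢Φ) e = classical-⇒-elim (⊢E⇒⊨E ⊢Φ⇒Ψ e) (⊢E⇒⊨E ⊢Φ e)
    ⊢E⇒⊨E (necE ⊢φ) e (v , _ , ¬φ) = ¬φ (⊢A⇒⊨A ⊢φ v)
    ⊢E⇒⊨E (mono⟨⟩ ⊢φ⇒ψ) e ((v , πe , φv) , ¬⟨a⟩ψ) =
      ¬⟨a⟩ψ (v , πe , classical-⇒-elim (⊢A⇒⊨A ⊢φ⇒ψ v) φv)
    ⊢E⇒⊨E (mono[] ⊢φ⇒ψ) e ([a]φ , ¬[a]ψ) =
      ¬[a]ψ λ { (v , πe , ¬ψ) → [a]φ (v , πe , λ φv → ¬ψ (classical-⇒-elim (⊢A⇒⊨A ⊢φ⇒ψ v) φv)) }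
    ⊢E⇒⊨E (adj1← ⊢◇Φ⇒ψ) e (Φe , ¬[a]ψ) =
      ¬[a]ψ λ { (v , πe , ¬ψ) → ¬ψ (classical-⇒-elim (⊢A⇒⊨A ⊢◇Φ⇒ψ v) (e , πe , Φe)) }
    ⊢E⇒⊨E (adj2→ ⊢φ⇒□Ψ) e ((v , πe , φv) , ¬Ψ) =
      classical-⇒-elim (⊢A⇒⊨A ⊢φ⇒□Ψ v) φv (e , πe , ¬Ψ)
    ⊢E⇒⊨E cover e = ⊨-someAgent e

mainTheorem4 : (n : ℕ) (AP : Fin n → Set) (APe : Set) → ExcludedMiddle 0ℓ →
    let open Logic n AP APe in
    (∀ (a : Agent) (φ : AF a) → ⊢A a φ → ∀ (M : Model) (v : Model.V M a) → _⊨A_ M v φ)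
    × (∀ (Φ : WF) → ⊢E Φ → ∀ (M : Model) (e : Model.E M) → _⊨E_ M e Φ)
mainTheorem4 n AP APe lem =
  (λ a φ ⊢φ M → Soundness.⊢A⇒⊨A lem M ⊢φ) , (λ Φ ⊢Φ M → Soundness.⊢E⇒⊨E lem M ⊢Φ)
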